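{- A graph $G$ with no isolated vertices is $4$-$\gamma_{tR}$-edge-critical if and only if its complement $\overline{G}$ is a galaxy.
   Context: All graphs are finite and simple. For a graph $G$ with no isolated vertices, a total Roman dominating function is a map $f:V(G)\to\{0,1,2\}$ such that every vertex with $f(v)=0$ is adjacent to a vertex $u$ with $f(u)=2$, and the subgraph induced by $\{v:f(v)>0\}$ has no isolated vertices; $\gamma_{tR}(G)$ is the minimum of $\sum_v f(v)$ over such $f$. $G$ is $k$-$\gamma_{tR}$-edge-critical if $\gamma_{tR}(G)=k$, $E(\overline{G})\neq\emptyset$ and $\gamma_{tR}(G+e)<\gamma_{tR}(G)$ for every $e\in E(\overline{G})$. A galaxy is a disjoint union of two or more non-trivial stars. -}

module Defs where

open import Data.Nat using (ℕ; _≤_; _<_)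
open import Data.Fin using (Fin; toℕ; _≟_)
open import Data.Bool using (Bool; true; false; not; _∧_; _∨_)
open import Data.List using (map; allFin)
open import Data.Nat.ListAction using (sum)
open import Data.Product using (Σ; ∃; _×_; _,_)
open import Data.Sum using (_⊎_)
open import Relation.Binary.PropositionalEquality using (_≡_; _≢_)
open import Relation.Nullary.Decidable using (⌊_⌋)
open import Function.Bundles using (_⇔_)

Adj : ℕ → Set
Adj n = Fin n → Fin n → Bool

IsSimple : ∀ {n} → Adj n → Set
IsSimple {n} A = (∀ u v → A u v ≡ A v u) × (∀ v → A v v ≡ false)

NoIsolated : ∀ {n} → Adj n → Set
NoIsolated {n} A = ∀ v → ∃ λ u → A v u ≡ true

complement : ∀ {n} → Adj n → Adj n
complement A u v = not (A u v) ∧ not ⌊ u ≟ v ⌋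

addEdge : ∀ {n} → Adj n → Fin n → Fin n → Adj n
addEdge A u v x y =
  A x y ∨ ((⌊ x ≟ u ⌋ ∧ ⌊ y ≟ v ⌋) ∨ (⌊ x ≟ v ⌋ ∧ ⌊ y ≟ u ⌋))

IsTRDF : ∀ {n} → Adj n → (Fin n → Fin 3) → Set
IsTRDF {n} A f =
  (∀ v → toℕ (f v) ≡ 0 → ∃ λ u → A v u ≡ true × toℕ (f u) ≡ 2)
  × (∀ v → 0 < toℕ (f v) → ∃ λ u → A v u ≡ true × 0 < toℕ (f u))

weight : ∀ {n} → (Fin n → Fin 3) → ℕ
weight {n} f = sum (map (λ v → toℕ (f v)) (allFin n))

HasγtR : ∀ {n} → Adj n → ℕ → Set
HasγtR {n} A k =
  (∃ λ f → IsTRDF A f × weight f ≡ k)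
  × (∀ f → IsTRDF A f → k ≤ weight f)

NonEdge : ∀ {n} → Adj n → Fin n → Fin n → Set
NonEdge A u v = u ≢ v × A u v ≡ false

EdgeCritical : ∀ {n} → ℕ → Adj n → Set
EdgeCritical {n} k A =
  HasγtR A k
  × (∃ λ u → ∃ λ v → NonEdge A u v)
  × (∀ u v → NonEdge A u v → ∃ λ k' → HasγtR (addEdge A u v) k' × k' < k)

-- Galaxy: disjoint union of at least two non-trivial stars (spanning all
-- vertices). Witnessed by a centre map c: c v is the centre of v's star.
IsGalaxy : ∀ {n} → Adj n → Set
IsGalaxy {n} H = Σ (Fin n → Fin n) λ c →
  (∀ v → c (c v) ≡ c v)
  × (∀ u v → (H u v ≡ true) ⇔ (u ≢ v × c u ≡ c v × (u ≡ c u ⊎ v ≡ c v)))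
  × (∀ v → ∃ λ u → u ≢ c v × c u ≡ c v)
  × (∃ λ u → ∃ λ v → c u ≢ c v)

module Submission where

-- A total Roman dominating function of weight less than 4 on a graph with at least four vertices
-- must assign 2 to some vertex w, 1 to one neighbour of w and 0 elsewhere, which forces w to be
-- universal; conversely a universal vertex gives weight 3, and an edge whose ends dominate every
-- other vertex gives weight 4. In both directions G has at least four vertices (the constant
-- labelling 1 has weight n; a galaxy has two stars with at least two vertices each). Hence
-- γ_tR(G) = 4 says that no vertex of G is universal, i.e. Ḡ has no isolated vertex, and
-- γ_tR(G + uv) < 4 says that u or v is universal in G + uv, i.e. is a leaf of Ḡ adjacent only to
-- the other end. A graph without isolated vertices in which every edge has a leaf end is a
-- disjoint union of non-trivial stars, and there are at least two stars since the centre of a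
-- spanning star would be isolated in G. Conversely, if Ḡ is a galaxy, two centres of different
-- stars form a dominating edge of G, and adding an edge of Ḡ to G makes its leaf end universal.

open import Defs
open import Algebra.Properties.CommutativeSemigroup using (x∙yz≈y∙xz)
open import Data.Bool as Bool using (true; false; not; _∧_; _∨_)
open import Data.Bool.Properties using (∨-comm; ∧-comm; ∨-zeroʳ; ∧-zeroʳ; ¬-not)
open import Data.Empty using (⊥)
open import Data.Fin using (Fin; toℕ; _≟_) renaming (suc to sucF)
open import Data.Fin.Patterns using (0F; 1F; 2F; 3F)
open import Data.Fin.Properties using (any?; all?; ≤-totalOrder; injective⇒≤)
open import Data.List using (tabulate)
open import Data.List.Properties using (map-tabulate)
open import Data.Nat as ℕ using (ℕ; zero; suc; _+_; _≤_; _<_; z≤n; z<s)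
open import Data.Nat.ListAction using (sum)
open import Data.Nat.Properties
  using ( ≤-trans; ≤-reflexive; +-mono-≤; +-monoʳ-≤; m≤m+n; +-identityʳ; +-commutativeSemigroup
        ; <⇒≱; ≮⇒≥; n≢0⇒n>0; n≤0⇒n≡0; n<1+n; n≤1+n; module ≤-Reasoning)
open import Data.Product using (∃; _×_; _,_; proj₁; proj₂)
open import Data.Sum as Sum using (_⊎_; inj₁; inj₂; [_,_])
open import Data.Vec.Functional using (updateAt)
open import Data.Vec.Functional.Properties using (updateAt-updates; updateAt-minimal)
open import Function using (_∘_; const)
open import Function.Bundles using (_⇔_; mk⇔; Equivalence)
open import Function.Properties.Equivalence using () renaming (sym to ⇔-sym; trans to ⇔-trans)
open import Relation.Binary.PropositionalEquality hiding ([_])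
open import Relation.Nullary using (¬_; Dec; yes; no; contradiction)
open import Relation.Nullary.Decidable using (⌊_⌋; _→-dec_; ¬?; _×-dec_)

∑ : ∀ {n} → (Fin n → ℕ) → ℕ
∑ g = sum (tabulate g)

∑-mono-≤ : ∀ {n} {g h : Fin n → ℕ} → (∀ i → g i ≤ h i) → ∑ g ≤ ∑ h
∑-mono-≤ {zero}  g≤h = z≤n
∑-mono-≤ {suc n} g≤h = +-mono-≤ (g≤h 0F) (∑-mono-≤ (g≤h ∘ sucF))

∑-const-1 : ∀ n → ∑ {n} (const 1) ≡ n
∑-const-1 zero    = refl
∑-const-1 (suc n) = cong suc (∑-const-1 n)

∑-zero : ∀ {n} {g : Fin n → ℕ} → (∀ i → g i ≡ 0) → ∑ g ≡ 0
∑-zero {zero}  g≡0 = refl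
∑-zero {suc n} g≡0 = cong₂ _+_ (g≡0 0F) (∑-zero (g≡0 ∘ sucF))

∑-updateAt-0 : ∀ {n} (g : Fin n → ℕ) i → ∑ g ≡ g i + ∑ (updateAt g i (const 0))
∑-updateAt-0 {suc n} g 0F       = refl
∑-updateAt-0 {suc n} g (sucF i) =
  trans (cong (g 0F +_) (∑-updateAt-0 (g ∘ sucF) i))
        (x∙yz≈y∙xz +-commutativeSemigroup (g 0F) (g (sucF i)) _)

∑-≥₁ : ∀ {n} {g : Fin n → ℕ} i → g i ≤ ∑ g
∑-≥₁ {g = g} i = ≤-trans (m≤m+n (g i) _) (≤-reflexive (sym (∑-updateAt-0 g i)))

∑-≥₂ : ∀ {n} {g : Fin n → ℕ} {i j} → j ≢ i → g i + g j ≤ ∑ g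
∑-≥₂ {g = g} {i} {j} j≢i = begin
  g i + g j                         ≡⟨ cong (g i +_) (sym (updateAt-minimal j i g j≢i)) ⟩
  g i + updateAt g i (const 0) j    ≤⟨ +-monoʳ-≤ (g i) (∑-≥₁ j) ⟩
  g i + ∑ (updateAt g i (const 0))  ≡⟨ sym (∑-updateAt-0 g i) ⟩
  ∑ g                               ∎
  where open ≤-Reasoning

∑-≥₃ : ∀ {n} {g : Fin n → ℕ} {i j k} → j ≢ i → k ≢ i → k ≢ j → g i + (g j + g k) ≤ ∑ g
∑-≥₃ {g = g} {i} {j} {k} j≢i k≢i k≢j = begin
  g i + (g j + g k)
    ≡⟨ cong (g i +_) (sym (cong₂ _+_ (updateAt-minimal j i g j≢i) (updateAt-minimal k i g k≢i))) ⟩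
  g i + (g′ j + g′ k)  ≤⟨ +-monoʳ-≤ (g i) (∑-≥₂ k≢j) ⟩
  g i + ∑ g′           ≡⟨ sym (∑-updateAt-0 g i) ⟩
  ∑ g                  ∎
  where
  open ≤-Reasoning
  g′ = updateAt g i (const 0)

∑-two : ∀ {n} {g : Fin n → ℕ} {i j} → j ≢ i → (∀ x → x ≢ i → x ≢ j → g x ≡ 0) → ∑ g ≡ g i + g j
∑-two {g = g} {i} {j} j≢i vanishes = begin
  ∑ g                   ≡⟨ ∑-updateAt-0 g i ⟩
  g i + ∑ g′            ≡⟨ cong (g i +_) (∑-updateAt-0 g′ j) ⟩
  g i + (g′ j + ∑ g″)   ≡⟨ cong₂ (λ a b → g i + (a + b)) (updateAt-minimal j i g j≢i) (∑-zero g″≡0) ⟩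
  g i + (g j + 0)       ≡⟨ cong (g i +_) (+-identityʳ (g j)) ⟩
  g i + g j             ∎
  where
  open ≡-Reasoning
  g′ = updateAt g i (const 0)
  g″ = updateAt g′ j (const 0)
  g″≡0 : ∀ x → g″ x ≡ 0
  g″≡0 x with x ≟ j | x ≟ i
  ... | yes refl | _        = updateAt-updates j g′
  ... | no x≢j   | yes refl = trans (updateAt-minimal x j g′ x≢j) (updateAt-updates x g)
  ... | no x≢j   | no x≢i   = trans (updateAt-minimal x j g′ x≢j)
                                    (trans (updateAt-minimal x i g x≢i) (vanishes x x≢i x≢j))

twoPairs⇒4≤n : ∀ {n} {X : Set} (c : Fin n → X) {a a′ b b′} → a′ ≢ a → b′ ≢ b →
  c a′ ≡ c a → c b′ ≡ c b → c a ≢ c b → 4 ≤ n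
twoPairs⇒4≤n c {a} {a′} {b} {b′} a′≢a b′≢b ca′≡ca cb′≡cb ca≢cb = injective⇒≤ injective
  where
  pick : Fin 4 → Fin _
  pick 0F = a
  pick 1F = a′
  pick 2F = b
  pick 3F = b′

  apart : ∀ {x y} → c x ≡ c a → c y ≡ c b → x ≢ y
  apart cx≡ca cy≡cb x≡y = ca≢cb (trans (sym cx≡ca) (trans (cong c x≡y) cy≡cb))

  injective : ∀ {i j} → pick i ≡ pick j → i ≡ j
  injective {0F} {0F} _ = refl
  injective {1F} {1F} _ = refl
  injective {2F} {2F} _ = refl
  injective {3F} {3F} _ = refl
  injective {0F} {1F} e = contradiction (sym e) a′≢a
  injective {1F} {0F} e = contradiction e a′≢a
  injective {2F} {3F} e = contradiction (sym e) b′≢b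
  injective {3F} {2F} e = contradiction e b′≢b
  injective {0F} {2F} e = contradiction e (apart refl refl)
  injective {0F} {3F} e = contradiction e (apart refl cb′≡cb)
  injective {1F} {2F} e = contradiction e (apart ca′≡ca refl)
  injective {1F} {3F} e = contradiction e (apart ca′≡ca cb′≡cb)
  injective {2F} {0F} e = contradiction (sym e) (apart refl refl)
  injective {3F} {0F} e = contradiction (sym e) (apart refl cb′≡cb)
  injective {2F} {1F} e = contradiction (sym e) (apart ca′≡ca refl)
  injective {3F} {1F} e = contradiction (sym e) (apart ca′≡ca cb′≡cb)

weight≡∑ : ∀ {n} (f : Fin n → Fin 3) → weight f ≡ ∑ (toℕ ∘ f)
weight≡∑ f = cong sum (map-tabulate (λ v → v) (toℕ ∘ f))

weight-allOnes : ∀ n → weight {n} (const 1F) ≡ n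
weight-allOnes n = trans (weight≡∑ {n} (const 1F)) (∑-const-1 n)

module _ {n : ℕ} (f : Fin n → Fin 3) where

  weight-≥₂ : ∀ {i j} → j ≢ i → toℕ (f i) + toℕ (f j) ≤ weight f
  weight-≥₂ j≢i = subst (_ ≤_) (sym (weight≡∑ f)) (∑-≥₂ j≢i)

  weight-≥₃ : ∀ {i j k} → j ≢ i → k ≢ i → k ≢ j → toℕ (f i) + (toℕ (f j) + toℕ (f k)) ≤ weight f
  weight-≥₃ j≢i k≢i k≢j = subst (_ ≤_) (sym (weight≡∑ f)) (∑-≥₃ j≢i k≢i k≢j)

twoPoint : ∀ {n} → Fin n → Fin 3 → Fin n → Fin 3 → Fin n → Fin 3
twoPoint a i b j x with x ≟ a | x ≟ b
... | yes _ | _     = i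
... | no _  | yes _ = j
... | no _  | no _  = 0F

module _ {n : ℕ} {a b : Fin n} {i j : Fin 3} where

  twoPoint-at₁ : twoPoint a i b j a ≡ i
  twoPoint-at₁ with a ≟ a
  ... | yes _  = refl
  ... | no a≢a = contradiction refl a≢a

  twoPoint-at₂ : b ≢ a → twoPoint a i b j b ≡ j
  twoPoint-at₂ b≢a with b ≟ a | b ≟ b
  ... | yes b≡a | _      = contradiction b≡a b≢a
  ... | no _    | yes _  = refl
  ... | no _    | no b≢b = contradiction refl b≢b

  twoPoint-elsewhere : ∀ {x} → x ≢ a → x ≢ b → twoPoint a i b j x ≡ 0F
  twoPoint-elsewhere {x} x≢a x≢b with x ≟ a | x ≟ b
  ... | yes x≡a | _       = contradiction x≡a x≢a
  ... | no _    | yes x≡b = contradiction x≡b x≢b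
  ... | no _    | no _    = refl

  weight-twoPoint : b ≢ a → weight (twoPoint a i b j) ≡ toℕ i + toℕ j
  weight-twoPoint b≢a = begin
    weight (twoPoint a i b j)                            ≡⟨ weight≡∑ (twoPoint a i b j) ⟩
    ∑ (toℕ ∘ twoPoint a i b j)
      ≡⟨ ∑-two b≢a (λ x x≢a x≢b → cong toℕ (twoPoint-elsewhere x≢a x≢b)) ⟩
    toℕ (twoPoint a i b j a) + toℕ (twoPoint a i b j b)
      ≡⟨ cong₂ (λ p q → toℕ p + toℕ q) twoPoint-at₁ (twoPoint-at₂ b≢a) ⟩
    toℕ i + toℕ j                                        ∎
    where open ≡-Reasoning

Universal : ∀ {n} → Adj n → Fin n → Set
Universal B w = ∀ x → x ≢ w → B w x ≡ true

Pendant : ∀ {n} → Adj n → Fin n → Fin n → Set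
Pendant H u v = ∀ x → H u x ≡ true → x ≡ v

adjacent⇒≢ : ∀ {n} {B : Adj n} {u v} → IsSimple B → B u v ≡ true → u ≢ v
adjacent⇒≢ {u = u} (_ , irrB) Buv refl with trans (sym Buv) (irrB u)
... | ()

module _ {n : ℕ} {A : Adj n} where

  nonEdge-sym : ∀ {u v} → IsSimple A → NonEdge A u v → NonEdge A v u
  nonEdge-sym {u} {v} (symA , _) (u≢v , Auv≡false) = u≢v ∘ sym , trans (symA v u) Auv≡false

  ¬universal⇒nonEdge : ∀ {w} → ¬ Universal A w → ∃ λ x → NonEdge A w x
  ¬universal⇒nonEdge {w} ¬universal with any? (λ x → ¬? (w ≟ x) ×-dec (A w x Bool.≟ false))
  ... | yes nonEdge = nonEdge
  ... | no ¬nonEdge =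
    contradiction (λ x x≢w → ¬-not λ Awx≡false → ¬nonEdge (x , x≢w ∘ sym , Awx≡false)) ¬universal

  complement-true⇔NonEdge : ∀ {u v} → complement A u v ≡ true ⇔ NonEdge A u v
  complement-true⇔NonEdge {u} {v} with A u v | u ≟ v
  ... | false | no u≢v  = mk⇔ (λ _ → u≢v , refl) (λ _ → refl)
  ... | false | yes u≡v = mk⇔ (λ ()) (λ (u≢v , _) → contradiction u≡v u≢v)
  ... | true  | _       = mk⇔ (λ ()) (λ ())

  complement-isSimple : IsSimple A → IsSimple (complement A)
  complement-isSimple (symA , _) = symmetric , irreflexive
    where
    ≟-sym : ∀ u v → ⌊ u ≟ v ⌋ ≡ ⌊ v ≟ u ⌋
    ≟-sym u v with u ≟ v | v ≟ u
    ... | yes _   | yes _   = refl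
    ... | no _    | no _    = refl
    ... | yes u≡v | no v≢u  = contradiction (sym u≡v) v≢u
    ... | no u≢v  | yes v≡u = contradiction (sym v≡u) u≢v

    symmetric : ∀ u v → complement A u v ≡ complement A v u
    symmetric u v = cong₂ (λ a b → not a ∧ not b) (symA u v) (≟-sym u v)

    irreflexive : ∀ v → complement A v v ≡ false
    irreflexive v with v ≟ v
    ... | yes _  = ∧-zeroʳ (not (A v v))
    ... | no v≢v = contradiction refl v≢v

  addEdge-⊇ : ∀ {u v x y} → A x y ≡ true → addEdge A u v x y ≡ true
  addEdge-⊇ Axy rewrite Axy = refl

  addEdge-new : ∀ {u v} → addEdge A u v u v ≡ true
  addEdge-new {u} {v} with u ≟ u | v ≟ v
  ... | yes _  | yes _  = ∨-zeroʳ (A u v)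
  ... | no u≢u | _      = contradiction refl u≢u
  ... | _      | no v≢v = contradiction refl v≢v

  addEdge-inv : ∀ {u v x y} → addEdge A u v x y ≡ true →
    A x y ≡ true ⊎ (x ≡ u × y ≡ v) ⊎ (x ≡ v × y ≡ u)
  addEdge-inv {u} {v} {x} {y} e with A x y | x ≟ u | y ≟ v | x ≟ v | y ≟ u
  ... | true  | _       | _       | _       | _       = inj₁ refl
  ... | false | yes x≡u | yes y≡v | _       | _       = inj₂ (inj₁ (x≡u , y≡v))
  ... | false | _       | _       | yes x≡v | yes y≡u = inj₂ (inj₂ (x≡v , y≡u))
  ... | false | no _    | _       | no _    | _       with () ← e
  ... | false | no _    | _       | yes _   | no _    with () ← e
  ... | false | yes _   | no _    | no _    | _       with () ← e
  ... | false | yes _   | no _    | yes _   | no _    with () ← e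

  addEdge-comm : ∀ {u v} x y → addEdge A u v x y ≡ addEdge A v u x y
  addEdge-comm {u} {v} x y =
    cong (A x y ∨_) (∨-comm (⌊ x ≟ u ⌋ ∧ ⌊ y ≟ v ⌋) (⌊ x ≟ v ⌋ ∧ ⌊ y ≟ u ⌋))

  addEdge-isSimple : ∀ {u v} → IsSimple A → u ≢ v → IsSimple (addEdge A u v)
  addEdge-isSimple {u} {v} (symA , irrA) u≢v = symmetric , irreflexive
    where
    symmetric : ∀ x y → addEdge A u v x y ≡ addEdge A u v y x
    symmetric x y = cong₂ _∨_ (symA x y) (begin
      (⌊ x ≟ u ⌋ ∧ ⌊ y ≟ v ⌋) ∨ (⌊ x ≟ v ⌋ ∧ ⌊ y ≟ u ⌋)
        ≡⟨ cong₂ _∨_ (∧-comm ⌊ x ≟ u ⌋ _) (∧-comm ⌊ x ≟ v ⌋ _) ⟩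
      (⌊ y ≟ v ⌋ ∧ ⌊ x ≟ u ⌋) ∨ (⌊ y ≟ u ⌋ ∧ ⌊ x ≟ v ⌋)
        ≡⟨ ∨-comm (⌊ y ≟ v ⌋ ∧ ⌊ x ≟ u ⌋) _ ⟩
      (⌊ y ≟ u ⌋ ∧ ⌊ x ≟ v ⌋) ∨ (⌊ y ≟ v ⌋ ∧ ⌊ x ≟ u ⌋) ∎)
      where open ≡-Reasoning

    irreflexive : ∀ x → addEdge A u v x x ≡ false
    irreflexive x = ¬-not (noLoop ∘ addEdge-inv)
      where
      noLoop : A x x ≡ true ⊎ (x ≡ u × x ≡ v) ⊎ (x ≡ v × x ≡ u) → ⊥
      noLoop (inj₁ Axx)                 = contradiction (trans (sym Axx) (irrA x)) λ ()
      noLoop (inj₂ (inj₁ (x≡u , x≡v))) = u≢v (trans (sym x≡u) x≡v)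
      noLoop (inj₂ (inj₂ (x≡v , x≡u))) = u≢v (trans (sym x≡u) x≡v)

  universal-addEdge : ∀ {u v w x} → Universal (addEdge A u v) w → NonEdge A w x →
    (w ≡ u × x ≡ v) ⊎ (w ≡ v × x ≡ u)
  universal-addEdge universal (w≢x , Awx≡false) with addEdge-inv (universal _ (w≢x ∘ sym))
  ... | inj₁ Awx = contradiction (trans (sym Awx) Awx≡false) λ ()
  ... | inj₂ new = new

  universal-addEdge⇒pendant : ∀ {u v w} → u ≢ v → Universal (addEdge A u v) w → ¬ Universal A w →
    Pendant (complement A) u v ⊎ Pendant (complement A) v u
  universal-addEdge⇒pendant {u} {v} {w} u≢v universal ¬universal
    with universal-addEdge {u = u} {v} universal (proj₂ (¬universal⇒nonEdge ¬universal))
  ... | inj₁ (refl , _) = inj₁ λ y Huy →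
    [ proj₂ , (λ (u≡v , _) → contradiction u≡v u≢v) ]
      (universal-addEdge {u = u} {v} universal (Equivalence.to complement-true⇔NonEdge Huy))
  ... | inj₂ (refl , _) = inj₂ λ y Hvy →
    [ (λ (v≡u , _) → contradiction (sym v≡u) u≢v) , proj₂ ]
      (universal-addEdge {u = u} {v} universal (Equivalence.to complement-true⇔NonEdge Hvy))

  pendant⇒universal-addEdge : ∀ {u v} → (∀ x → NonEdge A u x → x ≡ v) → Universal (addEdge A u v) u
  pendant⇒universal-addEdge {u} {v} pendant x x≢u = newOrOld (x ≟ v)
    where
    newOrOld : Dec (x ≡ v) → addEdge A u v u x ≡ true
    newOrOld (yes refl) = addEdge-new
    newOrOld (no x≢v)   = addEdge-⊇ (¬-not λ Aux≡false → x≢v (pendant x (x≢u ∘ sym , Aux≡false)))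

module _ {n : ℕ} {B : Adj n} where

  twoPoint-isTRDF : ∀ {a b} {i j : Fin 3} → IsSimple B → B a b ≡ true → 0 < toℕ i → 0 < toℕ j →
    (∀ x → x ≢ a → x ≢ b → (B x a ≡ true × toℕ i ≡ 2) ⊎ (B x b ≡ true × toℕ j ≡ 2)) →
    IsTRDF B (twoPoint a i b j)
  twoPoint-isTRDF {a} {b} {i} {j} simple@(symB , _) Bab i>0 j>0 dominatedBy = dominated , total
    where
    b≢a : b ≢ a
    b≢a = adjacent⇒≢ simple Bab ∘ sym

    dominated : ∀ v → toℕ (twoPoint a i b j v) ≡ 0 → ∃ λ u → B v u ≡ true × toℕ (twoPoint a i b j u) ≡ 2
    dominated v fv≡0 with v ≟ a | v ≟ b
    ... | yes refl | _        = contradiction (≤-reflexive fv≡0) (<⇒≱ i>0)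
    ... | no _     | yes refl = contradiction (≤-reflexive fv≡0) (<⇒≱ j>0)
    ... | no v≢a   | no v≢b   with dominatedBy v v≢a v≢b
    ...   | inj₁ (Bva , i≡2) = a , Bva , trans (cong toℕ (twoPoint-at₁ {b = b} {i} {j})) i≡2
    ...   | inj₂ (Bvb , j≡2) = b , Bvb , trans (cong toℕ (twoPoint-at₂ {i = i} {j} b≢a)) j≡2

    total : ∀ v → 0 < toℕ (twoPoint a i b j v) → ∃ λ u → B v u ≡ true × 0 < toℕ (twoPoint a i b j u)
    total v fv>0 with v ≟ a | v ≟ b
    ... | yes refl | _        = b , Bab , subst (λ k → 0 < toℕ k) (sym (twoPoint-at₂ {i = i} {j} b≢a)) j>0
    ... | no _     | yes refl =
      a , trans (symB b a) Bab , subst (λ k → 0 < toℕ k) (sym (twoPoint-at₁ {b = b} {i} {j})) i>0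
    ... | no _     | no _     with () ← fv>0

  starTRDF : ∀ {w u} → IsSimple B → Universal B w → u ≢ w → ∃ λ f → IsTRDF B f × weight f ≡ 3
  starTRDF {w} {u} simple@(symB , _) universal u≢w =
    twoPoint w 2F u 1F ,
    twoPoint-isTRDF simple (universal u u≢w) z<s z<s
      (λ x x≢w _ → inj₁ (trans (symB x w) (universal x x≢w) , refl)) ,
    weight-twoPoint u≢w

  dominatingEdgeTRDF : ∀ {a b} → IsSimple B → B a b ≡ true →
    (∀ x → x ≢ a → x ≢ b → B x a ≡ true ⊎ B x b ≡ true) → ∃ λ f → IsTRDF B f × weight f ≡ 4
  dominatingEdgeTRDF simple Bab dominatedBy =
    twoPoint _ 2F _ 2F ,
    twoPoint-isTRDF simple Bab z<s z<s (λ x x≢a x≢b → Sum.map (_, refl) (_, refl) (dominatedBy x x≢a x≢b)) ,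
    weight-twoPoint (adjacent⇒≢ simple Bab ∘ sym)

  allOnes-isTRDF : NoIsolated B → IsTRDF B (const 1F)
  allOnes-isTRDF noIsolated = (λ v ()) , (λ v _ → proj₁ (noIsolated v) , proj₂ (noIsolated v) , z<s)

  some2⊎n≤weight : ∀ {f} → IsTRDF B f → (∃ λ w → toℕ (f w) ≡ 2) ⊎ n ≤ weight f
  some2⊎n≤weight {f} (dominated , _) with any? (λ w → toℕ (f w) ℕ.≟ 2)
  ... | yes some2 = inj₁ some2
  ... | no no2    = inj₂ (begin
    n                ≡⟨ sym (∑-const-1 n) ⟩
    ∑ {n} (const 1)  ≤⟨ ∑-mono-≤ positive ⟩
    ∑ (toℕ ∘ f)      ≡⟨ sym (weight≡∑ f) ⟩
    weight f         ∎)
    where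
    open ≤-Reasoning
    positive : ∀ v → 1 ≤ toℕ (f v)
    positive v = n≢0⇒n>0 λ fv≡0 → let (u , _ , fu≡2) = dominated v fv≡0 in no2 (u , fu≡2)

  3≤weight : ∀ {f} → IsSimple B → 4 ≤ n → IsTRDF B f → 3 ≤ weight f
  3≤weight {f} simple 4≤n trdf@(_ , total) with some2⊎n≤weight trdf
  ... | inj₂ n≤w = ≤-trans (n≤1+n 3) (≤-trans 4≤n n≤w)
  ... | inj₁ (w , fw≡2) with total w (subst (0 <_) (sym fw≡2) z<s)
  ...   | u , Bwu , fu>0 =
    ≤-trans (+-mono-≤ (≤-reflexive (sym fw≡2)) fu>0) (weight-≥₂ f (adjacent⇒≢ simple Bwu ∘ sym))

  weight<4⇒universal : ∀ {f} → IsSimple B → 4 ≤ n → IsTRDF B f → weight f < 4 → ∃ (Universal B)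
  weight<4⇒universal {f} simple@(symB , _) 4≤n trdf@(dominated , total) w<4 with some2⊎n≤weight trdf
  ... | inj₂ n≤w = contradiction (≤-trans 4≤n n≤w) (<⇒≱ w<4)
  ... | inj₁ (w , fw≡2) with total w (subst (0 <_) (sym fw≡2) z<s)
  ...   | u , Bwu , fu>0 = w , universal
    where
    u≢w : u ≢ w
    u≢w = adjacent⇒≢ simple Bwu ∘ sym

    no2Elsewhere : ∀ y → y ≢ w → toℕ (f y) ≢ 2
    no2Elsewhere y y≢w fy≡2 =
      <⇒≱ w<4 (≤-trans (≤-reflexive (cong₂ _+_ (sym fw≡2) (sym fy≡2))) (weight-≥₂ f y≢w))

    0Elsewhere : ∀ x → x ≢ w → x ≢ u → toℕ (f x) ≡ 0
    0Elsewhere x x≢w x≢u = n≤0⇒n≡0 (≮⇒≥ λ fx>0 →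
      <⇒≱ w<4 (≤-trans (+-mono-≤ (≤-reflexive (sym fw≡2)) (+-mono-≤ fu>0 fx>0)) (weight-≥₃ f u≢w x≢w x≢u)))

    universal : Universal B w
    universal x x≢w with x ≟ u
    ... | yes refl = Bwu
    ... | no x≢u with dominated x (0Elsewhere x x≢w x≢u)
    ...   | y , Bxy , fy≡2 with y ≟ w
    ...     | yes refl = trans (symB w x) Bxy
    ...     | no y≢w   = contradiction fy≡2 (no2Elsewhere y y≢w)

  γtR<4⇒universal : ∀ {k} → IsSimple B → 4 ≤ n → HasγtR B k → k < 4 → ∃ (Universal B)
  γtR<4⇒universal simple 4≤n ((f , trdf , wf≡k) , _) k<4 =
    weight<4⇒universal simple 4≤n trdf (subst (_< 4) (sym wf≡k) k<4)

  universal⇒γtR≡3 : ∀ {w u} → IsSimple B → 4 ≤ n → Universal B w → u ≢ w → HasγtR B 3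
  universal⇒γtR≡3 simple 4≤n universal u≢w =
    starTRDF simple universal u≢w , λ f trdf → 3≤weight simple 4≤n trdf

  noUniversal⇒4≤weight : ∀ {f} → IsSimple B → 4 ≤ n → (∀ w → ¬ Universal B w) → IsTRDF B f →
    4 ≤ weight f
  noUniversal⇒4≤weight simple 4≤n noUniversal trdf =
    ≮⇒≥ λ w<4 → let (w , universal) = weight<4⇒universal simple 4≤n trdf w<4 in noUniversal w universal

record StarForest {n : ℕ} (H : Adj n) : Set where
  field
    centre      : Fin n → Fin n
    centre-idem : ∀ v → centre (centre v) ≡ centre v
    adjacent⇔   : ∀ u v → (H u v ≡ true) ⇔ (u ≢ v × centre u ≡ centre v × (u ≡ centre u ⊎ v ≡ centre v))
    nontrivial  : ∀ v → ∃ λ u → u ≢ centre v × centre u ≡ centre v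

module _ {n : ℕ} {H : Adj n} (simple : IsSimple H) (noIsolated : NoIsolated H)
         (pendantEdge : ∀ {u v} → H u v ≡ true → Pendant H u v ⊎ Pendant H v u) where

  open import Algebra.Construct.NaturalChoice.Min (≤-totalOrder n) using (_⊓_; ⊓-comm; ⊓-sel)

  private
    partner : Fin n → Fin n
    partner v = proj₁ (noIsolated v)

    adjacent-partner : ∀ v → H v (partner v) ≡ true
    adjacent-partner v = proj₂ (noIsolated v)

    partner≢ : ∀ v → partner v ≢ v
    partner≢ v = adjacent⇒≢ simple (adjacent-partner v) ∘ sym

    pendant⇒partner : ∀ {u v} → Pendant H u v → partner u ≡ v
    pendant⇒partner pendant = pendant _ (adjacent-partner _)

    IsLeaf : Fin n → Set
    IsLeaf v = Pendant H v (partner v)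

    isLeaf? : ∀ v → Dec (IsLeaf v)
    isLeaf? v = all? λ x → (H v x Bool.≟ true) →-dec (x ≟ partner v)

    -- Both ends of a single-edge star are leaves; the smaller one is taken as the centre.
    centre : Fin n → Fin n
    centre v with isLeaf? v | isLeaf? (partner v)
    ... | no _  | _     = v
    ... | yes _ | no _  = partner v
    ... | yes _ | yes _ = v ⊓ partner v

    centre-nonLeaf : ∀ {v} → ¬ IsLeaf v → centre v ≡ v
    centre-nonLeaf {v} ¬leaf with isLeaf? v
    ... | yes leaf = contradiction leaf ¬leaf
    ... | no _     = refl

    centre-leaf : ∀ {v} → IsLeaf v → ¬ IsLeaf (partner v) → centre v ≡ partner v
    centre-leaf {v} leaf ¬leaf with isLeaf? v | isLeaf? (partner v)
    ... | no ¬leaf′ | _         = contradiction leaf ¬leaf′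
    ... | yes _     | yes leaf′ = contradiction leaf′ ¬leaf
    ... | yes _     | no _      = refl

    centre-leaves : ∀ {v} → IsLeaf v → IsLeaf (partner v) → centre v ≡ v ⊓ partner v
    centre-leaves {v} leaf leaf′ with isLeaf? v | isLeaf? (partner v)
    ... | no ¬leaf | _         = contradiction leaf ¬leaf
    ... | yes _    | no ¬leaf′ = contradiction leaf′ ¬leaf′
    ... | yes _    | yes _     = refl

    centre-cases : ∀ v → centre v ≡ v ⊎ centre v ≡ partner v
    centre-cases v with isLeaf? v | isLeaf? (partner v)
    ... | no _  | _     = inj₁ refl
    ... | yes _ | no _  = inj₂ refl
    ... | yes _ | yes _ = ⊓-sel v (partner v)

    nonLeaf⇒centre : ∀ {u v} → H u v ≡ true → ¬ IsLeaf u → centre u ≡ u × centre v ≡ u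
    nonLeaf⇒centre {u} {v} Huv ¬leaf with pendantEdge Huv
    ... | inj₁ pendant = contradiction (subst (Pendant H u) (sym (pendant⇒partner pendant)) pendant) ¬leaf
    ... | inj₂ pendant = centre-nonLeaf ¬leaf , trans (centre-leaf leaf (¬leaf ∘ subst IsLeaf v↦u)) v↦u
      where
      v↦u : partner v ≡ u
      v↦u = pendant⇒partner pendant
      leaf : IsLeaf v
      leaf = subst (Pendant H v) (sym v↦u) pendant

    centre-edge : ∀ {u v} → H u v ≡ true → centre u ≡ centre v × (u ≡ centre u ⊎ v ≡ centre v)
    centre-edge {u} {v} Huv = byLeaves (isLeaf? u) (isLeaf? v)
      where
      Hvu : H v u ≡ true
      Hvu = trans (proj₁ simple v u) Huv

      byLeaves : Dec (IsLeaf u) → Dec (IsLeaf v) → centre u ≡ centre v × (u ≡ centre u ⊎ v ≡ centre v)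
      byLeaves (no ¬leaf) _ = let (cu , cv) = nonLeaf⇒centre Huv ¬leaf in trans cu (sym cv) , inj₁ (sym cu)
      byLeaves (yes _) (no ¬leaf) = let (cv , cu) = nonLeaf⇒centre Hvu ¬leaf in trans cu (sym cv) , inj₂ (sym cv)
      byLeaves (yes leafU) (yes leafV) = trans cu (trans (⊓-comm u v) (sym cv)) , centreAmong (⊓-sel u v)
        where
        u↦v : partner u ≡ v
        u↦v = sym (leafU v Huv)
        v↦u : partner v ≡ u
        v↦u = sym (leafV u Hvu)
        cu : centre u ≡ u ⊓ v
        cu = trans (centre-leaves leafU (subst IsLeaf (sym u↦v) leafV)) (cong (u ⊓_) u↦v)
        cv : centre v ≡ v ⊓ u
        cv = trans (centre-leaves leafV (subst IsLeaf (sym v↦u) leafU)) (cong (v ⊓_) v↦u)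
        centreAmong : u ⊓ v ≡ u ⊎ u ⊓ v ≡ v → u ≡ centre u ⊎ v ≡ centre v
        centreAmong (inj₁ m≡u) = inj₁ (sym (trans cu m≡u))
        centreAmong (inj₂ m≡v) = inj₂ (sym (trans cv (trans (⊓-comm v u) m≡v)))

    centre-partner : ∀ v → centre (partner v) ≡ centre v
    centre-partner v = sym (proj₁ (centre-edge (adjacent-partner v)))

    adjacent-centre : ∀ {u v} → u ≢ v → centre u ≡ centre v → u ≡ centre u → H u v ≡ true
    adjacent-centre {u} {v} u≢v cu≡cv u≡cu with centre-cases v
    ... | inj₁ cv≡v  = contradiction (trans u≡cu (trans cu≡cv cv≡v)) u≢v
    ... | inj₂ cv≡pv = trans (proj₁ simple u v)
                             (subst (λ x → H v x ≡ true) (sym (trans u≡cu (trans cu≡cv cv≡pv))) (adjacent-partner v))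

  starForest : StarForest H
  starForest = record
    { centre      = centre
    ; centre-idem = idem
    ; adjacent⇔   = λ u v → mk⇔ (λ Huv → adjacent⇒≢ simple Huv , centre-edge Huv) from
    ; nontrivial  = nontrivial
    }
    where
    idem : ∀ v → centre (centre v) ≡ centre v
    idem v with centre-cases v
    ... | inj₁ cv≡v  = cong centre cv≡v
    ... | inj₂ cv≡pv = trans (cong centre cv≡pv) (centre-partner v)

    from : ∀ {u v} → u ≢ v × centre u ≡ centre v × (u ≡ centre u ⊎ v ≡ centre v) → H u v ≡ true
    from (u≢v , cu≡cv , inj₁ u≡cu) = adjacent-centre u≢v cu≡cv u≡cu
    from {u} {v} (u≢v , cu≡cv , inj₂ v≡cv) =
      trans (proj₁ simple u v) (adjacent-centre (u≢v ∘ sym) (sym cu≡cv) v≡cv)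

    nontrivial : ∀ v → ∃ λ u → u ≢ centre v × centre u ≡ centre v
    nontrivial v with centre-cases v
    ... | inj₁ cv≡v  = partner v , (λ e → partner≢ v (trans e cv≡v)) , centre-partner v
    ... | inj₂ cv≡pv = v , (λ e → partner≢ v (sym (trans e cv≡pv))) , refl

module _ {n : ℕ} {A : Adj n} (simple : IsSimple A) (noIsolated : NoIsolated A) (critical : EdgeCritical 4 A) where

  private
    γtR≡4 : HasγtR A 4
    γtR≡4 = proj₁ critical

    4≤n : 4 ≤ n
    4≤n = subst (4 ≤_) (weight-allOnes n) (proj₂ γtR≡4 (const 1F) (allOnes-isTRDF noIsolated))

    noUniversal : ∀ w → ¬ Universal A w
    noUniversal w universal with starTRDF simple universal (adjacent⇒≢ simple (proj₂ (noIsolated w)) ∘ sym)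
    ... | f , trdf , wf≡3 = <⇒≱ (n<1+n 3) (subst (4 ≤_) wf≡3 (proj₂ γtR≡4 f trdf))

    noIsolated-complement : NoIsolated (complement A)
    noIsolated-complement w =
      let (x , nonEdge) = ¬universal⇒nonEdge {A = A} (noUniversal w)
      in  x , Equivalence.from (complement-true⇔NonEdge {A = A}) nonEdge

    pendantEdge : ∀ {u v} → complement A u v ≡ true → Pendant (complement A) u v ⊎ Pendant (complement A) v u
    pendantEdge {u} {v} Huv =
      let (k , γtR≡k , k<4) = proj₂ (proj₂ critical) u v nonEdge
          (w , universal)   = γtR<4⇒universal (addEdge-isSimple simple u≢v) 4≤n γtR≡k k<4
      in  universal-addEdge⇒pendant u≢v universal (noUniversal w)
      where
      nonEdge : NonEdge A u v
      nonEdge = Equivalence.to (complement-true⇔NonEdge {A = A}) Huv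
      u≢v : u ≢ v
      u≢v = proj₁ nonEdge

  edgeCritical⇒galaxy : IsGalaxy (complement A)
  edgeCritical⇒galaxy = centre , centre-idem , adjacent⇔ , nontrivial , z , b , differentStars
    where
    open StarForest (starForest (complement-isSimple simple) noIsolated-complement pendantEdge)

    z : Fin n
    z = centre (proj₁ (proj₁ (proj₂ critical)))

    b : Fin n
    b = proj₁ (noIsolated z)

    differentStars : centre z ≢ centre b
    differentStars cz≡cb = contradiction (trans (sym Azb) (proj₂ nonEdge)) λ ()
      where
      Azb = proj₂ (noIsolated z)
      nonEdge = Equivalence.to (complement-true⇔NonEdge {A = A})
        (Equivalence.from (adjacent⇔ z b) (adjacent⇒≢ simple Azb , cz≡cb , inj₁ (sym (centre-idem _))))

module _ {n : ℕ} {A : Adj n} (simple : IsSimple A) (forest : StarForest (complement A))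
         {u₀ v₀ : Fin n} (twoStars : StarForest.centre forest u₀ ≢ StarForest.centre forest v₀) where

  open StarForest forest

  private
    nonEdge⇔ : ∀ {u v} → NonEdge A u v ⇔ (u ≢ v × centre u ≡ centre v × (u ≡ centre u ⊎ v ≡ centre v))
    nonEdge⇔ {u} {v} = ⇔-trans (⇔-sym (complement-true⇔NonEdge {A = A})) (adjacent⇔ u v)

    differentStars⇒adjacent : ∀ {u v} → centre u ≢ centre v → A u v ≡ true
    differentStars⇒adjacent cu≢cv = ¬-not λ Auv≡false →
      cu≢cv (proj₁ (proj₂ (Equivalence.to nonEdge⇔ (cu≢cv ∘ cong centre , Auv≡false))))

    hasNonEdge : ∀ w → ∃ λ x → NonEdge A w x
    hasNonEdge w with w ≟ centre w
    ... | yes w≡cw = let (ℓ , ℓ≢cw , cℓ≡cw) = nontrivial w in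
      ℓ , Equivalence.from nonEdge⇔ ((λ w≡ℓ → ℓ≢cw (trans (sym w≡ℓ) w≡cw)) , sym cℓ≡cw , inj₁ w≡cw)
    ... | no w≢cw  = centre w , Equivalence.from nonEdge⇔ (w≢cw , sym (centre-idem w) , inj₂ (sym (centre-idem w)))

    noUniversal : ∀ w → ¬ Universal A w
    noUniversal w universal =
      let (x , w≢x , Awx≡false) = hasNonEdge w
      in  contradiction (trans (sym (universal x (w≢x ∘ sym))) Awx≡false) λ ()

    z₁ z₂ : Fin n
    z₁ = centre u₀
    z₂ = centre v₀

    cz₁≢cz₂ : centre z₁ ≢ centre z₂
    cz₁≢cz₂ e = twoStars (trans (sym (centre-idem u₀)) (trans e (centre-idem v₀)))

    4≤n : 4 ≤ n
    4≤n = twoPairs⇒4≤n centre (proj₁ (proj₂ (nontrivial u₀))) (proj₁ (proj₂ (nontrivial v₀)))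
      (trans (proj₂ (proj₂ (nontrivial u₀))) (sym (centre-idem u₀)))
      (trans (proj₂ (proj₂ (nontrivial v₀))) (sym (centre-idem v₀)))
      cz₁≢cz₂

    γtR≡4 : HasγtR A 4
    γtR≡4 = dominatingEdgeTRDF simple (differentStars⇒adjacent cz₁≢cz₂) dominated ,
            λ f trdf → noUniversal⇒4≤weight simple 4≤n noUniversal trdf
      where
      dominated : ∀ x → x ≢ z₁ → x ≢ z₂ → A x z₁ ≡ true ⊎ A x z₂ ≡ true
      dominated x _ _ with centre x ≟ z₁
      ... | no cx≢z₁  = inj₁ (differentStars⇒adjacent λ e → cx≢z₁ (trans e (centre-idem u₀)))
      ... | yes cx≡z₁ =
        inj₂ (differentStars⇒adjacent λ e → twoStars (trans (sym cx≡z₁) (trans e (centre-idem v₀))))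

    pendant : ∀ {u v} → NonEdge A u v → v ≡ centre v → ∀ x → NonEdge A u x → x ≡ v
    pendant uv v≡cv x ux with Equivalence.to nonEdge⇔ uv | Equivalence.to nonEdge⇔ ux
    ... | u≢v , cu≡cv , _ | _ , _     , inj₁ u≡cu = contradiction (trans u≡cu (trans cu≡cv (sym v≡cv))) u≢v
    ... | _   , cu≡cv , _ | _ , cu≡cx , inj₂ x≡cx = trans x≡cx (trans (sym cu≡cx) (trans cu≡cv (sym v≡cv)))

    addEdge-γtR≡3 : ∀ {u v} → NonEdge A u v → HasγtR (addEdge A u v) 3
    addEdge-γtR≡3 {u} {v} uv@(u≢v , _) with proj₂ (proj₂ (Equivalence.to nonEdge⇔ uv))
    ... | inj₂ v≡cv = universal⇒γtR≡3 (addEdge-isSimple simple u≢v) 4≤n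
                        (pendant⇒universal-addEdge {A = A} (pendant uv v≡cv)) (u≢v ∘ sym)
    ... | inj₁ u≡cu = universal⇒γtR≡3 (addEdge-isSimple simple u≢v) 4≤n universal u≢v
      where
      universal : Universal (addEdge A u v) v
      universal x x≢v = trans (addEdge-comm {A = A} {u} {v} v x)
        (pendant⇒universal-addEdge {A = A} (pendant (nonEdge-sym simple uv) u≡cu) x x≢v)

  starForest⇒edgeCritical : EdgeCritical 4 A
  starForest⇒edgeCritical = γtR≡4 , (u₀ , hasNonEdge u₀) , λ u v uv → 3 , addEdge-γtR≡3 uv , n<1+n 3

mainTheorem2 : (n : ℕ) (A : Adj n) → IsSimple A → NoIsolated A →
    (EdgeCritical 4 A ⇔ IsGalaxy (complement A))
mainTheorem2 n A simple noIsolated = mk⇔ (edgeCritical⇒galaxy simple noIsolated) galaxy⇒edgeCritical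
  where
  galaxy⇒edgeCritical : IsGalaxy (complement A) → EdgeCritical 4 A
  galaxy⇒edgeCritical (centre , centre-idem , adjacent⇔ , nontrivial , _ , _ , twoStars) =
    starForest⇒edgeCritical simple
      (record { centre = centre ; centre-idem = centre-idem ; adjacent⇔ = adjacent⇔ ; nontrivial = nontrivial })
      twoStars
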